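{- Let $s\ge 3$ and let $H$ be a graph with $|V(H)|\ge s$ such that: (i) $H$ contains $t$ distinct subgraphs $H_1,\dots,H_t$, each isomorphic to $K_s$ (with $H_i\neq H_j$ for $i\neq j$); and (ii) $H$ contains an edge $e\in E(H)$ such that $H-e$ contains no subgraph isomorphic to $K_s$. Then $$t\le \prod_{j=0}^{s-3}\left\lceil \frac{(|V(H)|-2)-j}{s-2}\right\rceil.$$ Moreover, for each number of vertices there is always a graph $H$ with properties (i) and (ii) for which $t$ equals this value.
   Context: $K_s$ denotes the complete graph on $s$ vertices; $H-e$ denotes $H$ with the edge $e$ deleted (vertices kept). -}

module Defs where

open import Level using (0ℓ)
open import Data.Nat using (ℕ; zero; suc; _+_; _∸_; _≤_)
open import Data.Nat.DivMod using (_/_)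
open import Data.Fin using (Fin)
open import Data.Fin.Subset using (Subset; _∈_; ∣_∣)
open import Data.List using (List; map; upTo)
open import Data.Nat.ListAction using (product)
open import Data.Product using (Σ; _×_)
open import Relation.Binary.PropositionalEquality using (_≡_; _≢_)
open import Relation.Nullary using (¬_)
open import Function.Definitions using (Injective)

record Graph (n : ℕ) : Set₁ where
  field
    Adj     : Fin n → Fin n → Set
    sym     : ∀ {x y} → Adj x y → Adj y x
    irrefl  : ∀ {x} → ¬ Adj x x
open Graph public

deleteEdge : ∀ {n} → (H : Graph n) → (u v : Fin n) → Graph n
deleteEdge H u v = record
  { Adj    = λ x y → Adj H x y × ¬ (x ≡ u × y ≡ v) × ¬ (x ≡ v × y ≡ u)
  ; sym    = λ { (a , p , q) → sym H a , (λ { (e1 , e2) → q (e2 , e1) })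
                                       , (λ { (e1 , e2) → p (e2 , e1) }) }
  ; irrefl = λ { (a , _ , _) → irrefl H a }
  }
  where open import Data.Product using (_,_)

-- A subgraph of H isomorphic to K_s is determined by its vertex set S:
-- |S| = s and all pairs of distinct vertices of S are adjacent in H
-- (the subgraph consists of S together with all edges between them).
IsKsVertexSet : ∀ {n} → Graph n → ℕ → Subset n → Set
IsKsVertexSet H s S =
  ∣ S ∣ ≡ s × (∀ x y → x ∈ S → y ∈ S → x ≢ y → Adj H x y)

HasDistinctKs : ∀ {n} → Graph n → ℕ → ℕ → Set
HasDistinctKs {n} H s t =
  Σ (Fin t → Subset n) λ K →
    Injective _≡_ _≡_ K × (∀ i → IsKsVertexSet H s (K i))

KsFree : ∀ {n} → Graph n → ℕ → Set
KsFree {n} H s = ∀ (S : Subset n) → ¬ IsKsVertexSet H s S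

HasCriticalEdge : ∀ {n} → Graph n → ℕ → Set
HasCriticalEdge {n} H s =
  Σ (Fin n) λ u → Σ (Fin n) λ v → Adj H u v × KsFree (deleteEdge H u v) s

-- ⌈ a / (suc d) ⌉
ceilDiv : ℕ → ℕ → ℕ
ceilDiv a d = (a + d) / suc d

-- ∏_{j=0}^{s-3} ⌈ ((m - 2) - j) / (s - 2) ⌉   (for s ≥ 3)
bound : ℕ → ℕ → ℕ
bound m s = go (s ∸ 2)
  where
    go : ℕ → ℕ
    go zero    = 1
    go (suc d) = product (map (λ j → ceilDiv ((m ∸ 2) ∸ j) d) (upTo (suc d)))

{-# OPTIONS --safe #-}
-- Every K_s of H contains both ends u, v of the critical edge, since otherwise it would survive in H − uv.
-- Deleting u and v turns the t copies into t distinct (s−2)-cliques, on the remaining n − 2 vertices, of the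
-- graph joining two vertices when some copy contains both; that graph has no (s−1)-clique, which together
-- with u would be a K_s of H − uv. In a K_{r+1}-free graph on m vertices pick a vertex w lying in the most
-- r-cliques: every r-clique meets the set A of non-neighbours of w, so double counting bounds their number
-- by |A| times the number through w, and those, with w removed, are (r−1)-cliques in the K_r-free
-- neighbourhood of w. Hence there are at most a₁ ⋯ a_r r-cliques for some a₁ + ⋯ + a_r ≤ m, and Bernoulli's
-- inequality, as a/q ≤ (1 + 1/q)^(a − q) for q = ⌊m/r⌋, bounds such a product by ∏_j ⌈(m − j)/r⌉.
-- Equality holds for the edge uv joined to the Turán graph T(n − 2, s − 2): its K_s are uv plus one vertex
-- of each part, while a K_s of H − uv misses u or v and so would need s vertices in s − 1 colour classes.
module Submission where

open import Defs hiding (sym)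
open import Data.Bool using (true; false)
import Data.Nat as ℕ
open import Data.Nat using (ℕ; zero; suc; _+_; _*_; _∸_; _^_; _≤_; _<_; z≤n; s≤s; s≤s⁻¹; z<s; s<s; NonZero)
open import Data.Nat.Properties
open import Data.Fin using (Fin; zero; suc; toℕ; fromℕ<; cast; remQuot; combine) renaming (_≟_ to _≟ᶠ_)
open import Data.Fin.Properties using (toℕ-injective; toℕ-fromℕ<; toℕ<n; toℕ-cast; combine-remQuot)
import Data.Fin.Properties as Fin
open import Data.Fin.Subset
  using (Subset; ⊥; _∈_; _∉_; _⊆_; ∣_∣; ⊤; ⁅_⁆; _∪_; _∩_; _─_; _-_; ∁; inside; outside; Nonempty)
open import Data.Fin.Subset.Properties
open import Data.Vec.Base using ([]; _∷_; here; there; tabulate; tail)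
import Data.List as List
open import Data.List using (List; []; _∷_; length; map; filter; replicate; allFin; upTo; applyUpTo)
open import Data.List.Properties using (length-tabulate; length-map; length-replicate; filter-accept; filter-none; map-upTo)
open import Data.List.Relation.Unary.All as All using (All; []; _∷_)
import Data.List.Relation.Unary.All.Properties as All
open import Data.List.Relation.Unary.AllPairs using ([]; _∷_)
open import Data.List.Relation.Unary.Unique.Propositional using (Unique)
import Data.List.Relation.Unary.Unique.Propositional.Properties as Unique
open import Data.List.Membership.Propositional.Properties using (∈-allFin)
open import Data.List.Extrema.Nat using (argmax; f[xs]≤f[argmax])
open import Data.Nat.ListAction using (sum; product)
open import Data.Nat.DivMod using (_/_; _%_; _mod_; m/n*n≤m; [m+kn]%n≡m%n; m<n⇒m%n≡m; m≡m%n+[m/n]*n; m%n<n; m<n⇒m/n≡0; m/n≡0⇒m<n; m*n/n≡m; +-distrib-/-∣ʳ)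
open import Data.Nat.Divisibility using (n∣m*n)
open import Data.Nat.Tactic.RingSolver using (solve-∀)
open import Algebra.Properties.CommutativeSemigroup +-commutativeSemigroup using (x∙yz≈y∙xz)
open import Data.Product using (Σ; ∃-syntax; _×_; _,_; proj₁; proj₂)
open import Data.Sum using (_⊎_; inj₁; inj₂)
open import Data.Empty using (⊥-elim)
open import Function using (_∘_; _on_)
open import Function.Definitions using (Injective)
open import Relation.Binary.PropositionalEquality
open import Relation.Nullary using (¬_; ¬?; _×-dec_; Dec; yes; no; does; contradiction)
open import Relation.Unary using (Pred; Decidable)
open import Relation.Binary using (Rel; Symmetric)
open import Level using (Level)

private
  variable
    ℓ : Level
    n : ℕ
    p q : Subset n
    x y : Fin n

-- Subsets of Fin n

x∈p─q⇒x∉q : x ∈ p ─ q → x ∉ q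
x∈p─q⇒x∉q {p = _ ∷ _} {q = _ ∷ _} (there x∈p─q) (there x∈q) = x∈p─q⇒x∉q x∈p─q x∈q

x∈p-y⇒x≢y : x ∈ p - y → x ≢ y
x∈p-y⇒x≢y {y = y} x∈p-x refl = x∈p─q⇒x∉q x∈p-x (x∈⁅x⁆ y)

x∈p-y⇒x∈p : x ∈ p - y → x ∈ p
x∈p-y⇒x∈p {p = p} {y = y} = p─q⊆p p ⁅ y ⁆

x∈p⇒suc∣p-x∣≡∣p∣ : x ∈ p → suc ∣ p - x ∣ ≡ ∣ p ∣
x∈p⇒suc∣p-x∣≡∣p∣ {x = zero}  {p = inside ∷ p}  here        = cong (ℕ.suc ∘ ∣_∣) (p─⊥≡p p)
x∈p⇒suc∣p-x∣≡∣p∣ {x = suc x} {p = inside ∷ p}  (there x∈p) = cong suc (x∈p⇒suc∣p-x∣≡∣p∣ x∈p)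
x∈p⇒suc∣p-x∣≡∣p∣ {x = suc x} {p = outside ∷ p} (there x∈p) = x∈p⇒suc∣p-x∣≡∣p∣ x∈p

x∈p⇒∣p∣>0 : x ∈ p → 0 < ∣ p ∣
x∈p⇒∣p∣>0 x∈p = subst (0 <_) (x∈p⇒suc∣p-x∣≡∣p∣ x∈p) (s≤s z≤n)

∣p∣>0⇒Nonempty : ∀ {n} {p : Subset n} → 0 < ∣ p ∣ → Nonempty p
∣p∣>0⇒Nonempty {n = n} {p = p} ∣p∣>0 with nonempty? p
... | yes ne = ne
... | no ¬ne = contradiction (trans (cong ∣_∣ (Empty-unique ¬ne)) (∣⊥∣≡0 n)) (>⇒≢ ∣p∣>0)

∣⊤-x∣≡n : ∀ (x : Fin (suc n)) → ∣ ⊤ - x ∣ ≡ n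
∣⊤-x∣≡n {n} x = suc-injective (trans (x∈p⇒suc∣p-x∣≡∣p∣ (∈⊤ {x = x})) (∣⊤∣≡n (suc n)))

p-x≡q-x⇒p≡q : x ∈ p → x ∈ q → p - x ≡ q - x → p ≡ q
p-x≡q-x⇒p≡q x∈p x∈q eq = ⊆-antisym (p⊆q x∈q eq) (p⊆q x∈p (sym eq))
  where
  p⊆q : ∀ {x} {p q : Subset n} → x ∈ q → p - x ≡ q - x → p ⊆ q
  p⊆q {x = x} x∈q eq {y} y∈p with y ≟ᶠ x
  ... | yes refl = x∈q
  ... | no y≢x   = x∈p-y⇒x∈p (subst (y ∈_) eq (x∈p∧x≢y⇒x∈p-y y∈p y≢x))

p⊆q⇒p-x⊆q-x : p ⊆ q → p - x ⊆ q - x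
p⊆q⇒p-x⊆q-x p⊆q y∈ = x∈p∧x≢y⇒x∈p-y (p⊆q (x∈p-y⇒x∈p y∈)) (x∈p-y⇒x≢y y∈)

x∈⁅y⁆∪p⁻ : x ∈ ⁅ y ⁆ ∪ p → x ≡ y ⊎ x ∈ p
x∈⁅y⁆∪p⁻ {y = y} {p = p} x∈ with x∈p∪q⁻ ⁅ y ⁆ p x∈
... | inj₁ x∈⁅y⁆ = inj₁ (x∈⁅y⁆⇒x≡y y x∈⁅y⁆)
... | inj₂ x∈p   = inj₂ x∈p

x∈⁅x⁆∪p : ∀ (p : Subset n) → x ∈ ⁅ x ⁆ ∪ p
x∈⁅x⁆∪p {x = x} p = p⊆p∪q p (x∈⁅x⁆ x)

x∉p⇒[⁅x⁆∪p]-x≡p : x ∉ p → (⁅ x ⁆ ∪ p) - x ≡ p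
x∉p⇒[⁅x⁆∪p]-x≡p {x = x} {p = p} x∉p = ⊆-antisym ⊆p p⊆
  where
  ⊆p : (⁅ x ⁆ ∪ p) - x ⊆ p
  ⊆p y∈ with x∈⁅y⁆∪p⁻ (x∈p-y⇒x∈p y∈)
  ... | inj₁ refl = contradiction refl (x∈p-y⇒x≢y y∈)
  ... | inj₂ y∈p  = y∈p
  p⊆ : p ⊆ (⁅ x ⁆ ∪ p) - x
  p⊆ y∈p = x∈p∧x≢y⇒x∈p-y (q⊆p∪q ⁅ x ⁆ p y∈p) (λ { refl → x∉p y∈p })

x∉p⇒∣⁅x⁆∪p∣≡suc∣p∣ : x ∉ p → ∣ ⁅ x ⁆ ∪ p ∣ ≡ suc ∣ p ∣
x∉p⇒∣⁅x⁆∪p∣≡suc∣p∣ {x = x} {p = p} x∉p =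
  trans (sym (x∈p⇒suc∣p-x∣≡∣p∣ (x∈⁅x⁆∪p {x = x} p))) (cong (ℕ.suc ∘ ∣_∣) (x∉p⇒[⁅x⁆∪p]-x≡p x∉p))

∣p∣≡0⇒p≡⊥ : ∣ p ∣ ≡ 0 → p ≡ ⊥
∣p∣≡0⇒p≡⊥ ∣p∣≡0 = Empty-unique λ (_ , x∈p) → >⇒≢ (x∈p⇒∣p∣>0 x∈p) ∣p∣≡0

∣p∩∁q∣+∣p∩q∣≡∣p∣ : ∀ (p q : Subset n) → ∣ p ∩ ∁ q ∣ + ∣ p ∩ q ∣ ≡ ∣ p ∣
∣p∩∁q∣+∣p∩q∣≡∣p∣ []            []            = refl
∣p∩∁q∣+∣p∩q∣≡∣p∣ (inside  ∷ p) (inside  ∷ q) = trans (+-suc _ _) (cong ℕ.suc (∣p∩∁q∣+∣p∩q∣≡∣p∣ p q))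
∣p∩∁q∣+∣p∩q∣≡∣p∣ (inside  ∷ p) (outside ∷ q) = cong ℕ.suc (∣p∩∁q∣+∣p∩q∣≡∣p∣ p q)
∣p∩∁q∣+∣p∩q∣≡∣p∣ (outside ∷ p) (_       ∷ q) = ∣p∩∁q∣+∣p∩q∣≡∣p∣ p q

select : {P : Pred (Fin n) ℓ} → Decidable P → Subset n
select P? = tabulate (does ∘ P?)

∈-select⁺ : {P : Pred (Fin n) ℓ} (P? : Decidable P) → P x → x ∈ select P?
∈-select⁺ {x = zero} P? px with P? zero
... | yes _   = here
... | no ¬px  = contradiction px ¬px
∈-select⁺ {x = suc x} P? px = there (∈-select⁺ (P? ∘ suc) px)

∈-select⁻ : {P : Pred (Fin n) ℓ} (P? : Decidable P) → x ∈ select P? → P x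
∈-select⁻ {x = zero} P? x∈ with P? zero
... | yes px = px
∈-select⁻ {x = suc x} P? (there x∈) = ∈-select⁻ (P? ∘ suc) x∈

IsClique : Rel (Fin n) ℓ → Subset n → Set ℓ
IsClique R p = ∀ x y → x ∈ p → y ∈ p → x ≢ y → R x y

IsClique-⊆ : ∀ {R : Rel (Fin n) ℓ} → q ⊆ p → IsClique R p → IsClique R q
IsClique-⊆ q⊆p clique x y x∈q y∈q = clique x y (q⊆p x∈q) (q⊆p y∈q)

IsClique-∷⁻ : ∀ {R : Rel (Fin (suc n)) ℓ} {b} →
              IsClique R (b ∷ p) → IsClique (λ x y → R (suc x) (suc y)) p
IsClique-∷⁻ clique x y x∈p y∈p x≢y =
  clique (suc x) (suc y) (there x∈p) (there y∈p) (x≢y ∘ Fin.suc-injective)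

IsClique-⁅x⁆∪ : ∀ {R : Rel (Fin n) ℓ} → Symmetric R →
                IsClique R p → (∀ {y} → y ∈ p → R x y) → IsClique R (⁅ x ⁆ ∪ p)
IsClique-⁅x⁆∪ R-sym clique adj y z y∈ z∈ y≢z with x∈⁅y⁆∪p⁻ y∈ | x∈⁅y⁆∪p⁻ z∈
... | inj₁ refl | inj₁ refl = contradiction refl y≢z
... | inj₁ refl | inj₂ z∈p  = adj z∈p
... | inj₂ y∈p  | inj₁ refl = R-sym (adj y∈p)
... | inj₂ y∈p  | inj₂ z∈p  = clique y z y∈p z∈p y≢z

-- IsClique (_≢_ on f) p says that f is injective on p.
subset-pigeonhole : ∀ {m k} {p : Subset m} {q : Subset k} (f : Fin m → Fin k) →
                    IsClique (_≢_ on f) p → (∀ {x} → x ∈ p → f x ∈ q) → ∣ p ∣ ≤ ∣ q ∣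
subset-pigeonhole {p = []} f _ _ = z≤n
subset-pigeonhole {p = outside ∷ p} f injective maps =
  subset-pigeonhole (f ∘ suc) (IsClique-∷⁻ injective) (maps ∘ there)
subset-pigeonhole {p = inside ∷ p} {q = q} f injective maps = begin
  suc ∣ p ∣             ≤⟨ s≤s (subset-pigeonhole (f ∘ suc) (IsClique-∷⁻ injective) maps-q-f₀) ⟩
  suc ∣ q - f zero ∣    ≡⟨ x∈p⇒suc∣p-x∣≡∣p∣ (maps here) ⟩
  ∣ q ∣                 ∎
  where
  open ≤-Reasoning
  maps-q-f₀ : ∀ {x} → x ∈ p → f (suc x) ∈ q - f zero
  maps-q-f₀ x∈p = x∈p∧x≢y⇒x∈p-y (maps (there x∈p)) (injective _ zero (there x∈p) here λ ())

-- Counting cliques in graphs without K_{r+1}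

Unique-map⁺-on : ∀ {A B : Set} {P : Pred A ℓ} {f : A → B} {xs} →
                 (∀ {a b} → P a → P b → f a ≡ f b → a ≡ b) → All P xs → Unique xs → Unique (map f xs)
Unique-map⁺-on inj [] [] = []
Unique-map⁺-on inj (pa ∷ ps) (a≢xs ∷ uniq) =
  All.map⁺ (All.zipWith (λ (a≢b , pb) → a≢b ∘ inj pa pb) (a≢xs , ps)) ∷ Unique-map⁺-on inj ps uniq

degree : Fin n → List (Subset n) → ℕ
degree x F = length (filter (x ∈?_) F)

degree-suc : ∀ (x : Fin n) F → degree (suc x) F ≡ degree x (map tail F)
degree-suc x [] = refl
degree-suc x ((_ ∷ S) ∷ F) with does (x ∈? S)
... | true  = cong ℕ.suc (degree-suc x F)
... | false = degree-suc x F

degree-∉ : ∀ {F : List (Subset n)} → All (x ∉_) F → degree x F ≡ 0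
degree-∉ {x = x} x∉F = cong length (filter-none (x ∈?_) x∉F)

x∈S⇒degree>0 : ∀ {S} (F : List (Subset n)) → x ∈ S → 0 < degree x (S ∷ F)
x∈S⇒degree>0 {x = x} F x∈S = subst (0 <_) (sym (cong length (filter-accept (x ∈?_) {xs = F} x∈S))) (s≤s z≤n)

degree>0⇒∈ : ∀ {U} {F : List (Subset n)} → All (_⊆ U) F → 0 < degree x F → x ∈ U
degree>0⇒∈ {x = x} {U} F⊆U degree>0 with x ∈? U
... | yes x∈U = x∈U
... | no  x∉U = contradiction (degree-∉ (All.map (λ S⊆U x∈S → x∉U (S⊆U x∈S)) F⊆U)) (>⇒≢ degree>0)

degree≤-tail : ∀ (F : List (Subset (suc n))) {M} → (∀ a → degree a F ≤ M) → ∀ a → degree a (map tail F) ≤ M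
degree≤-tail F {M} bounded a = subst (_≤ M) (degree-suc a F) (bounded (suc a))

incidences : Subset n → List (Subset n) → ℕ
incidences A F = sum (map (λ S → ∣ A ∩ S ∣) F)

incidences-[] : ∀ (F : List (Subset 0)) → incidences [] F ≡ 0
incidences-[] []       = refl
incidences-[] ([] ∷ F) = incidences-[] F

incidences-outside : ∀ (A : Subset n) F → incidences (outside ∷ A) F ≡ incidences A (map tail F)
incidences-outside A []            = refl
incidences-outside A ((_ ∷ S) ∷ F) = cong (∣ A ∩ S ∣ +_) (incidences-outside A F)

incidences-inside : ∀ (A : Subset n) F →
                    incidences (inside ∷ A) F ≡ degree zero F + incidences A (map tail F)
incidences-inside A [] = refl
incidences-inside A ((inside ∷ S) ∷ F) =
  cong ℕ.suc (trans (cong (∣ A ∩ S ∣ +_) (incidences-inside A F)) (x∙yz≈y∙xz ∣ A ∩ S ∣ (degree zero F) _))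
incidences-inside A ((outside ∷ S) ∷ F) =
  trans (cong (∣ A ∩ S ∣ +_) (incidences-inside A F)) (x∙yz≈y∙xz ∣ A ∩ S ∣ (degree zero F) _)

length≤incidences : ∀ (A : Subset n) {F} → All (λ S → Nonempty (A ∩ S)) F → length F ≤ incidences A F
length≤incidences A []                 = z≤n
length≤incidences A ((_ , x∈) ∷ meets) = +-mono-≤ (x∈p⇒∣p∣>0 x∈) (length≤incidences A meets)

incidences≤∣A∣*maxDegree : ∀ (A : Subset n) F {M} → (∀ a → degree a F ≤ M) → incidences A F ≤ ∣ A ∣ * M
incidences≤∣A∣*maxDegree []            F _       = ≤-reflexive (incidences-[] F)
incidences≤∣A∣*maxDegree (outside ∷ A) F bounded = begin
  incidences (outside ∷ A) F   ≡⟨ incidences-outside A F ⟩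
  incidences A (map tail F)    ≤⟨ incidences≤∣A∣*maxDegree A (map tail F) (degree≤-tail F bounded) ⟩
  ∣ A ∣ * _                    ∎
  where open ≤-Reasoning
incidences≤∣A∣*maxDegree (inside ∷ A) F bounded = begin
  incidences (inside ∷ A) F                ≡⟨ incidences-inside A F ⟩
  degree zero F + incidences A (map tail F) ≤⟨ +-mono-≤ (bounded zero) (incidences≤∣A∣*maxDegree A (map tail F) (degree≤-tail F bounded)) ⟩
  _ + ∣ A ∣ * _                            ∎
  where open ≤-Reasoning

length≤∣A∣*maxDegree : ∀ (A : Subset n) {F M} → All (λ S → Nonempty (A ∩ S)) F → (∀ a → degree a F ≤ M) →
                       length F ≤ ∣ A ∣ * M
length≤∣A∣*maxDegree A {F} meets bounded =
  ≤-trans (length≤incidences A meets) (incidences≤∣A∣*maxDegree A F bounded)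

link : Fin n → List (Subset n) → List (Subset n)
link x F = map (_- x) (filter (x ∈?_) F)

length-link : ∀ (x : Fin n) F → length (link x F) ≡ degree x F
length-link x F = length-map (_- x) (filter (x ∈?_) F)

Unique-link : ∀ (x : Fin n) {F} → Unique F → Unique (link x F)
Unique-link x {F} uniq =
  Unique-map⁺-on p-x≡q-x⇒p≡q (All.all-filter (x ∈?_) F) (Unique.filter⁺ (x ∈?_) uniq)

All-link : ∀ {P Q : Pred (Subset n) ℓ} (x : Fin n) {F} →
           (∀ {S} → x ∈ S → P S → Q (S - x)) → All P F → All Q (link x F)
All-link x {F} PQ all =
  All.map⁺ (All.map (λ (x∈S , PS) → PQ x∈S PS) (All.zip (All.all-filter (x ∈?_) F , All.filter⁺ (x ∈?_) all)))

Unique-∣∣≡0⇒length≤1 : ∀ {F : List (Subset n)} → Unique F → All (λ S → ∣ S ∣ ≡ 0) F → length F ≤ 1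
Unique-∣∣≡0⇒length≤1 {F = []}         _ _ = z≤n
Unique-∣∣≡0⇒length≤1 {F = _ ∷ []}     _ _ = s≤s z≤n
Unique-∣∣≡0⇒length≤1 {F = _ ∷ _ ∷ _} ((S≢S′ ∷ _) ∷ _) (∣S∣≡0 ∷ ∣S′∣≡0 ∷ _) =
  contradiction (trans (∣p∣≡0⇒p≡⊥ ∣S∣≡0) (sym (∣p∣≡0⇒p≡⊥ ∣S′∣≡0))) S≢S′

sum-replicate-0 : ∀ k → sum (replicate k 0) ≡ 0
sum-replicate-0 zero    = refl
sum-replicate-0 (suc k) = sum-replicate-0 k

module CliqueCount {n} (G : Graph n) (adj? : ∀ x y → Dec (Adj G x y)) where

  neighbours : Fin n → Subset n
  neighbours x = select (adj? x)

  IsCliqueIn : Subset n → ℕ → Subset n → Set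
  IsCliqueIn U r S = ∣ S ∣ ≡ r × S ⊆ U × IsClique (Adj G) S

  CliqueFreeIn : Subset n → ℕ → Set
  CliqueFreeIn U k = ∀ T → ¬ IsCliqueIn U k T

  x∉neighbours[x] : ∀ {x} → x ∉ neighbours x
  x∉neighbours[x] {x} x∈ = irrefl G (∈-select⁻ (adj? x) x∈)

  clique⊈neighbours : ∀ {U k x T} → CliqueFreeIn U (suc k) → x ∈ U → IsCliqueIn U k T →
                      ¬ (T ⊆ neighbours x)
  clique⊈neighbours {U} {x = x} {T} free x∈U (∣T∣≡k , T⊆U , clique) T⊆N =
    free (⁅ x ⁆ ∪ T)
      ( trans (x∉p⇒∣⁅x⁆∪p∣≡suc∣p∣ (x∉neighbours[x] ∘ T⊆N)) (cong ℕ.suc ∣T∣≡k)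
      , ⁅x⁆∪T⊆U
      , IsClique-⁅x⁆∪ (Graph.sym G) clique (∈-select⁻ (adj? x) ∘ T⊆N) )
    where
    ⁅x⁆∪T⊆U : ⁅ x ⁆ ∪ T ⊆ U
    ⁅x⁆∪T⊆U y∈ with x∈⁅y⁆∪p⁻ y∈
    ... | inj₁ refl = x∈U
    ... | inj₂ y∈T  = T⊆U y∈T

  CliqueFreeIn-neighbours : ∀ {U k x} → CliqueFreeIn U (suc k) → x ∈ U →
                            CliqueFreeIn (U ∩ neighbours x) k
  CliqueFreeIn-neighbours {U} {x = x} free x∈U T (∣T∣≡k , T⊆U∩N , clique) =
    clique⊈neighbours free x∈U (∣T∣≡k , proj₁ ∘ ∈∩ , clique) (proj₂ ∘ ∈∩)
    where
    ∈∩ : ∀ {y} → y ∈ T → y ∈ U × y ∈ neighbours x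
    ∈∩ y∈T = x∈p∩q⁻ U (neighbours x) (T⊆U∩N y∈T)

  IsCliqueIn-link : ∀ {U r x S} → x ∈ S → IsCliqueIn U (suc r) S →
                    IsCliqueIn (U ∩ neighbours x) r (S - x)
  IsCliqueIn-link {U} {x = x} {S} x∈S (∣S∣≡1+r , S⊆U , clique) =
    suc-injective (trans (x∈p⇒suc∣p-x∣≡∣p∣ x∈S) ∣S∣≡1+r) , S-x⊆U∩N ,
    λ y z y∈ z∈ → clique y z (x∈p-y⇒x∈p y∈) (x∈p-y⇒x∈p z∈)
    where
    S-x⊆U∩N : S - x ⊆ U ∩ neighbours x
    S-x⊆U∩N y∈ = x∈p∩q⁺ ( S⊆U (x∈p-y⇒x∈p y∈)
                        , ∈-select⁺ (adj? x) (clique x _ x∈S (x∈p-y⇒x∈p y∈) (≢-sym (x∈p-y⇒x≢y y∈))) )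

  clique-meets-non-neighbours : ∀ {U r x S} → CliqueFreeIn U (suc r) → x ∈ U → IsCliqueIn U r S →
                                Nonempty ((U ∩ ∁ (neighbours x)) ∩ S)
  clique-meets-non-neighbours {U} {x = x} {S} free x∈U S-clique@(_ , S⊆U , _)
    with nonempty? ((U ∩ ∁ (neighbours x)) ∩ S)
  ... | yes meets = meets
  ... | no ¬meets = ⊥-elim (clique⊈neighbours free x∈U S-clique S⊆N)
    where
    S⊆N : S ⊆ neighbours x
    S⊆N {y} y∈S with y ∈? neighbours x
    ... | yes y∈N = y∈N
    ... | no  y∉N = contradiction (y , x∈p∩q⁺ (x∈p∩q⁺ (S⊆U y∈S , x∉p⇒x∈∁p y∉N) , y∈S)) ¬meets

  cliques≤product : ∀ r U F → Unique F → All (IsCliqueIn U r) F → CliqueFreeIn U (suc r) →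
                    ∃[ as ] length as ≡ r × sum as ≤ ∣ U ∣ × length F ≤ product as
  cliques≤product zero U F uniq cliques _ =
    [] , refl , z≤n , Unique-∣∣≡0⇒length≤1 uniq (All.map proj₁ cliques)
  cliques≤product (suc r) U [] _ _ _ =
    replicate (suc r) 0 , length-replicate (suc r) , ≤-trans (≤-reflexive (sum-replicate-0 r)) z≤n , z≤n
  cliques≤product (suc r) U F@(S₀ ∷ _) uniq cliques@((∣S₀∣≡1+r , _) ∷ _) free =
    ∣ A ∣ ∷ as , cong ℕ.suc length-as , sum-as , length-F
    where
    a₀∈S₀ : Nonempty S₀
    a₀∈S₀ = ∣p∣>0⇒Nonempty (subst (0 <_) (sym ∣S₀∣≡1+r) (s≤s z≤n))
    a₀ = proj₁ a₀∈S₀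

    w : Fin n
    w = argmax (λ y → degree y F) a₀ (allFin n)

    degree≤degree[w] : ∀ y → degree y F ≤ degree w F
    degree≤degree[w] y = All.lookup (f[xs]≤f[argmax] {f = λ y → degree y F} a₀ (allFin n)) (∈-allFin y)

    w∈U : w ∈ U
    w∈U = degree>0⇒∈ (All.map (proj₁ ∘ proj₂) cliques) (≤-trans (x∈S⇒degree>0 _ (proj₂ a₀∈S₀)) (degree≤degree[w] a₀))

    A = U ∩ ∁ (neighbours w)

    IH = cliques≤product r (U ∩ neighbours w) (link w F) (Unique-link w uniq)
           (All-link w IsCliqueIn-link cliques) (CliqueFreeIn-neighbours free w∈U)
    as = proj₁ IH
    length-as = proj₁ (proj₂ IH)

    sum-as : ∣ A ∣ + sum as ≤ ∣ U ∣
    sum-as = begin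
      ∣ A ∣ + sum as                  ≤⟨ +-monoʳ-≤ ∣ A ∣ (proj₁ (proj₂ (proj₂ IH))) ⟩
      ∣ A ∣ + ∣ U ∩ neighbours w ∣    ≡⟨ ∣p∩∁q∣+∣p∩q∣≡∣p∣ U (neighbours w) ⟩
      ∣ U ∣                           ∎
      where open ≤-Reasoning

    length-F : length F ≤ ∣ A ∣ * product as
    length-F = begin
      length F                  ≤⟨ length≤∣A∣*maxDegree A (All.map (clique-meets-non-neighbours free w∈U) cliques) degree≤degree[w] ⟩
      ∣ A ∣ * degree w F        ≡⟨ cong (∣ A ∣ *_) (length-link w F) ⟨
      ∣ A ∣ * length (link w F) ≤⟨ *-monoʳ-≤ ∣ A ∣ (proj₂ (proj₂ (proj₂ IH))) ⟩
      ∣ A ∣ * product as        ∎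
      where open ≤-Reasoning

-- Products with a bounded sum

bernoulli : ∀ q k → (q + k) * q ^ k ≤ q * suc q ^ k
bernoulli q zero    = ≤-reflexive (cong (_* 1) (+-identityʳ q))
bernoulli q (suc k) = begin
  (q + suc k) * (q * q ^ k)         ≡⟨ e₁ q k (q ^ k) ⟩
  q * ((q + k) * q ^ k + q ^ k)     ≤⟨ *-monoʳ-≤ q (+-mono-≤ (bernoulli q k) (^-monoˡ-≤ k (n≤1+n q))) ⟩
  q * (q * suc q ^ k + suc q ^ k)   ≡⟨ e₂ q (suc q ^ k) ⟩
  q * (suc q * suc q ^ k)           ∎
  where
  open ≤-Reasoning
  e₁ : ∀ q k X → (q + suc k) * (q * X) ≡ q * ((q + k) * X + X)
  e₁ = solve-∀
  e₂ : ∀ q X → q * (q * X + X) ≡ q * (suc q * X)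
  e₂ = solve-∀

bernoulli⁻ : ∀ q m → m ≤ q → (q ∸ m) * suc q ^ m ≤ q * q ^ m
bernoulli⁻ q zero    _   = ≤-refl
bernoulli⁻ q (suc m) m<q = begin
  c * (suc q * X)         ≡⟨ e₁ c q X ⟩
  (c + c * q) * X         ≤⟨ *-monoˡ-≤ X (+-mono-≤ (m∸n≤m q (suc m)) (≤-reflexive (*-comm c q))) ⟩
  (q + q * c) * X         ≡⟨ e₂ c q X ⟩
  q * (suc c * X)         ≡⟨ cong (λ c′ → q * (c′ * X)) (+-∸-assoc 1 m<q) ⟨
  q * ((q ∸ m) * X)       ≤⟨ *-monoʳ-≤ q (bernoulli⁻ q m (<⇒≤ m<q)) ⟩
  q * (q * q ^ m)         ∎
  where
  open ≤-Reasoning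
  c = q ∸ suc m
  X = suc q ^ m
  e₁ : ∀ c q X → c * (suc q * X) ≡ (c + c * q) * X
  e₁ = solve-∀
  e₂ : ∀ c q X → (q + q * c) * X ≡ q * (suc c * X)
  e₂ = solve-∀

-- a/q ≤ (1 + 1/q)^(a − q), with the exponent split into its positive and negative parts.
bernoulli± : ∀ q a → a * q ^ (a ∸ q) * suc q ^ (q ∸ a) ≤ q * suc q ^ (a ∸ q) * q ^ (q ∸ a)
bernoulli± q a with ≤-total q a
... | inj₁ q≤a rewrite m≤n⇒m∸n≡0 q≤a =
  *-monoˡ-≤ 1 (subst (λ a′ → a′ * q ^ (a ∸ q) ≤ q * suc q ^ (a ∸ q)) (m+[n∸m]≡n q≤a) (bernoulli q (a ∸ q)))
... | inj₂ a≤q rewrite m≤n⇒m∸n≡0 a≤q | *-identityʳ a | *-identityʳ q =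
  subst (λ a′ → a′ * suc q ^ (q ∸ a) ≤ q * q ^ (q ∸ a)) (m∸[m∸n]≡n a≤q) (bernoulli⁻ q (q ∸ a) (m∸n≤m q a))

excess deficit : ℕ → List ℕ → ℕ
excess  q as = sum (map (_∸ q) as)
deficit q as = sum (map (q ∸_) as)

product-bernoulli± : ∀ q as → product as * q ^ excess q as * suc q ^ deficit q as
                              ≤ q ^ length as * suc q ^ excess q as * q ^ deficit q as
product-bernoulli± q []       = ≤-refl
product-bernoulli± q (a ∷ as) = begin
  (a * P) * q ^ (a⁺ + E) * q′ ^ (a⁻ + D)
    ≡⟨ cong₂ (λ u v → (a * P) * u * v) (^-distribˡ-+-* q a⁺ E) (^-distribˡ-+-* q′ a⁻ D) ⟩
  (a * P) * (q ^ a⁺ * q ^ E) * (q′ ^ a⁻ * q′ ^ D)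
    ≡⟨ e₁ a P (q ^ a⁺) (q ^ E) (q′ ^ a⁻) (q′ ^ D) ⟩
  (a * q ^ a⁺ * q′ ^ a⁻) * (P * q ^ E * q′ ^ D)
    ≤⟨ *-mono-≤ (bernoulli± q a) (product-bernoulli± q as) ⟩
  (q * q′ ^ a⁺ * q ^ a⁻) * (q ^ length as * q′ ^ E * q ^ D)
    ≡⟨ e₂ q (q′ ^ a⁺) (q ^ a⁻) (q ^ length as) (q′ ^ E) (q ^ D) ⟩
  (q * q ^ length as) * (q′ ^ a⁺ * q′ ^ E) * (q ^ a⁻ * q ^ D)
    ≡⟨ cong₂ (λ u v → (q * q ^ length as) * u * v) (^-distribˡ-+-* q′ a⁺ E) (^-distribˡ-+-* q a⁻ D) ⟨
  (q * q ^ length as) * q′ ^ (a⁺ + E) * q ^ (a⁻ + D) ∎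
  where
  open ≤-Reasoning
  q′ = suc q
  P  = product as
  a⁺  = a ∸ q
  a⁻  = q ∸ a
  E  = excess q as
  D  = deficit q as
  e₁ : ∀ a P A B C D → (a * P) * (A * B) * (C * D) ≡ (a * A * C) * (P * B * D)
  e₁ = solve-∀
  e₂ : ∀ q A B C D G → (q * A * B) * (C * D * G) ≡ (q * C) * (A * D) * (B * G)
  e₂ = solve-∀

sum+deficit≡length*q+excess : ∀ q as → sum as + deficit q as ≡ length as * q + excess q as
sum+deficit≡length*q+excess q [] = refl
sum+deficit≡length*q+excess q (a ∷ as) = begin
  (a + sum as) + ((q ∸ a) + deficit q as)   ≡⟨ e a (sum as) (q ∸ a) (deficit q as) ⟩
  (a + (q ∸ a)) + (sum as + deficit q as)   ≡⟨ cong₂ _+_ a+[q∸a]≡q+[a∸q] (sum+deficit≡length*q+excess q as) ⟩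
  (q + (a ∸ q)) + (length as * q + excess q as) ≡⟨ e q (a ∸ q) (length as * q) (excess q as) ⟩
  (q + length as * q) + ((a ∸ q) + excess q as) ∎
  where
  open ≡-Reasoning
  e : ∀ a b c d → (a + b) + (c + d) ≡ (a + c) + (b + d)
  e = solve-∀
  a+[q∸a]≡q+[a∸q] : a + (q ∸ a) ≡ q + (a ∸ q)
  a+[q∸a]≡q+[a∸q] with ≤-total q a
  ... | inj₁ q≤a = trans (cong (a +_) (m≤n⇒m∸n≡0 q≤a)) (trans (+-identityʳ a) (sym (m+[n∸m]≡n q≤a)))
  ... | inj₂ a≤q = trans (m+[n∸m]≡n a≤q) (sym (trans (cong (q +_) (m≤n⇒m∸n≡0 a≤q)) (+-identityʳ q)))

-- The product of the bernoulli± inequalities; the weights cancel because excess = ρ + deficit.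
product≤balancedPowers : ∀ q .{{_ : NonZero q}} ρ as → sum as ≡ ρ + q * length as → ρ ≤ length as →
                         product as ≤ q ^ (length as ∸ ρ) * suc q ^ ρ
product≤balancedPowers q ρ as sum≡ ρ≤r = *-cancelʳ-≤ _ _ Z {{Z≢0}} (begin
  P * Z                                  ≡⟨ e₁ P (q ^ ρ) (q ^ D) (q′ ^ D) ⟩
  P * (q ^ ρ * q ^ D) * q′ ^ D           ≡⟨ cong (λ t → P * t * q′ ^ D) (^-distribˡ-+-* q ρ D) ⟨
  P * q ^ (ρ + D) * q′ ^ D               ≡⟨ cong (λ e → P * q ^ e * q′ ^ D) excess≡ρ+deficit ⟨
  P * q ^ E * q′ ^ D                     ≤⟨ product-bernoulli± q as ⟩
  q ^ r * q′ ^ E * q ^ D                 ≡⟨ cong₂ (λ r′ e → q ^ r′ * q′ ^ e * q ^ D) (m∸n+n≡m ρ≤r) (sym excess≡ρ+deficit) ⟨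
  q ^ ((r ∸ ρ) + ρ) * q′ ^ (ρ + D) * q ^ D
    ≡⟨ cong₂ (λ u v → u * v * q ^ D) (^-distribˡ-+-* q (r ∸ ρ) ρ) (^-distribˡ-+-* q′ ρ D) ⟩
  (q ^ (r ∸ ρ) * q ^ ρ) * (q′ ^ ρ * q′ ^ D) * q ^ D
    ≡⟨ e₂ (q ^ (r ∸ ρ)) (q ^ ρ) (q′ ^ ρ) (q′ ^ D) (q ^ D) ⟩
  (q ^ (r ∸ ρ) * q′ ^ ρ) * Z             ∎)
  where
  open ≤-Reasoning
  q′ = suc q
  r  = length as
  P  = product as
  E  = excess q as
  D  = deficit q as
  Z  = q ^ ρ * (q ^ D * q′ ^ D)
  Z≢0 : NonZero Z
  Z≢0 = m*n≢0 (q ^ ρ) _ {{m^n≢0 q ρ}} {{m*n≢0 (q ^ D) (q′ ^ D) {{m^n≢0 q D}} {{m^n≢0 q′ D}}}}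
  e₁ : ∀ P A B C → P * (A * (B * C)) ≡ P * (A * B) * C
  e₁ = solve-∀
  e₂ : ∀ X A Y W C → (X * A) * (Y * W) * C ≡ (X * Y) * (A * (C * W))
  e₂ = solve-∀
  e₃ : ∀ ρ q r D → ρ + q * r + D ≡ r * q + (ρ + D)
  e₃ = solve-∀
  excess≡ρ+deficit : E ≡ ρ + D
  excess≡ρ+deficit = +-cancelˡ-≡ (r * q) E (ρ + D) (begin-equality
    r * q + E          ≡⟨ sum+deficit≡length*q+excess q as ⟨
    sum as + D         ≡⟨ cong (_+ D) sum≡ ⟩
    ρ + q * r + D      ≡⟨ e₃ ρ q r D ⟩
    r * q + (ρ + D)    ∎)

[t+q*n]/n≡q : ∀ {t n} q .{{_ : NonZero n}} → t < n → (t + q * n) / n ≡ q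
[t+q*n]/n≡q {t} {n} q t<n = begin
  (t + q * n) / n       ≡⟨ +-distrib-/-∣ʳ t (n∣m*n q) ⟩
  t / n + q * n / n     ≡⟨ cong₂ _+_ (m<n⇒m/n≡0 t<n) (m*n/n≡m q n) ⟩
  q                     ∎
  where open ≡-Reasoning

product-applyUpTo-const : ∀ (h : ℕ → ℕ) {B} k → (∀ {i} → i < k → h i ≡ B) → product (applyUpTo h k) ≡ B ^ k
product-applyUpTo-const h zero    _  = refl
product-applyUpTo-const h (suc k) hB = cong₂ _*_ (hB z<s) (product-applyUpTo-const (h ∘ suc) k (hB ∘ s<s))

product-applyUpTo-split : ∀ (h : ℕ → ℕ) {A B} ρ k → (∀ {i} → i < ρ → h i ≡ A) → (∀ {i} → i < k → h (ρ + i) ≡ B) →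
                          product (applyUpTo h (ρ + k)) ≡ A ^ ρ * B ^ k
product-applyUpTo-split h zero    k _  hB = trans (product-applyUpTo-const h k hB) (sym (*-identityˡ _))
product-applyUpTo-split h {A} (suc ρ) k hA hB =
  trans (cong₂ _*_ (hA z<s) (product-applyUpTo-split (h ∘ suc) ρ k (hA ∘ s<s) hB)) (sym (*-assoc A _ _))

balancedProduct : ℕ → ℕ → ℕ
balancedProduct N d = product (map (λ j → ceilDiv (N ∸ j) d) (upTo (suc d)))

balancedProduct≡balancedPowers : ∀ q .{{_ : NonZero q}} d ρ → ρ < suc d →
                                 balancedProduct (ρ + q * suc d) d ≡ q ^ (suc d ∸ ρ) * suc q ^ ρ
balancedProduct≡balancedPowers q d ρ ρ<r = begin
  product (map h (upTo r))             ≡⟨ cong product (map-upTo h r) ⟩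
  product (applyUpTo h r)              ≡⟨ cong (product ∘ applyUpTo h) (m+[n∸m]≡n (<⇒≤ ρ<r)) ⟨
  product (applyUpTo h (ρ + (r ∸ ρ)))  ≡⟨ product-applyUpTo-split h ρ (r ∸ ρ) h-low h-high ⟩
  suc q ^ ρ * q ^ (r ∸ ρ)              ≡⟨ *-comm (suc q ^ ρ) _ ⟩
  q ^ (r ∸ ρ) * suc q ^ ρ              ∎
  where
  open ≡-Reasoning
  r = suc d
  h : ℕ → ℕ
  h j = ceilDiv ((ρ + q * r) ∸ j) d
  h-low : ∀ {i} → i < ρ → h i ≡ suc q
  h-low {i} i<ρ = begin
    ((ρ + q * r) ∸ i + d) / r             ≡⟨ cong (λ t → (t + d) / r) (+-∸-comm (q * r) (<⇒≤ i<ρ)) ⟩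
    ((ρ ∸ i) + q * r + d) / r             ≡⟨ cong (λ t → (t + q * r + d) / r) (+-∸-assoc 1 i<ρ) ⟩
    (suc (ρ ∸ suc i) + q * r + d) / r     ≡⟨ cong (_/ r) (e (ρ ∸ suc i) q d) ⟩
    ((ρ ∸ suc i) + suc q * r) / r         ≡⟨ [t+q*n]/n≡q (suc q) (≤-<-trans (m∸n≤m ρ (suc i)) ρ<r) ⟩
    suc q                                 ∎
    where
    e : ∀ t q d → suc t + q * suc d + d ≡ t + suc q * suc d
    e = solve-∀
  h-high : ∀ {i} → i < r ∸ ρ → h (ρ + i) ≡ q
  h-high {i} i<r∸ρ = begin
    ((ρ + q * r) ∸ (ρ + i) + d) / r   ≡⟨ cong (λ t → (t + d) / r) ([m+n]∸[m+o]≡n∸o ρ (q * r) i) ⟩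
    (q * r ∸ i + d) / r               ≡⟨ cong (_/ r) (+-∸-comm d i≤q*r) ⟨
    (q * r + d ∸ i) / r               ≡⟨ cong (_/ r) (+-∸-assoc (q * r) i≤d) ⟩
    (q * r + (d ∸ i)) / r             ≡⟨ cong (_/ r) (+-comm (q * r) (d ∸ i)) ⟩
    ((d ∸ i) + q * r) / r             ≡⟨ [t+q*n]/n≡q q (s≤s (m∸n≤m d i)) ⟩
    q                                 ∎
    where
    i≤d : i ≤ d
    i≤d = m<1+n⇒m≤n (≤-trans i<r∸ρ (m∸n≤m r ρ))
    i≤q*r : i ≤ q * r
    i≤q*r = ≤-trans (≤-trans i≤d (n≤1+n d)) (m≤n*m r q)

sum<length⇒product≡0 : ∀ as → sum as < length as → product as ≡ 0
sum<length⇒product≡0 (zero  ∷ as) _ = refl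
sum<length⇒product≡0 (suc a ∷ as) (s≤s sum<length) =
  trans (cong (suc a *_) (sum<length⇒product≡0 as (≤-trans (s≤s (m≤n+m (sum as) a)) sum<length)))
        (*-zeroʳ (suc a))

product≤balancedProduct[sum] : ∀ d as → length as ≡ suc d → product as ≤ balancedProduct (sum as) d
product≤balancedProduct[sum] d as length≡r with sum as / suc d in q≡
... | zero = subst (_≤ balancedProduct (sum as) d) (sym (sum<length⇒product≡0 as sum<length)) z≤n
  where
  sum<length : sum as < length as
  sum<length = subst (sum as <_) (sym length≡r) (m/n≡0⇒m<n q≡)
... | q@(suc _) = begin
  product as                          ≤⟨ product≤balancedPowers q ρ as sum≡ (subst (ρ ≤_) (sym length≡r) (<⇒≤ ρ<r)) ⟩
  q ^ (length as ∸ ρ) * suc q ^ ρ     ≡⟨ cong (λ r → q ^ (r ∸ ρ) * suc q ^ ρ) length≡r ⟩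
  q ^ (suc d ∸ ρ) * suc q ^ ρ         ≡⟨ balancedProduct≡balancedPowers q d ρ ρ<r ⟨
  balancedProduct (ρ + q * suc d) d   ≡⟨ cong (λ N → balancedProduct N d) sum≡ρ+q*r ⟨
  balancedProduct (sum as) d          ∎
  where
  open ≤-Reasoning
  ρ = sum as % suc d
  ρ<r : ρ < suc d
  ρ<r = m%n<n (sum as) (suc d)
  sum≡ρ+q*r : sum as ≡ ρ + q * suc d
  sum≡ρ+q*r = trans (m≡m%n+[m/n]*n (sum as) (suc d)) (cong (λ q → ρ + q * suc d) q≡)
  sum≡ : sum as ≡ ρ + q * length as
  sum≡ = trans sum≡ρ+q*r (cong (λ r → ρ + q * r) (sym length≡r))

product≤balancedProduct : ∀ d as {N} → length as ≡ suc d → sum as ≤ N → product as ≤ balancedProduct N d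
product≤balancedProduct d (a ∷ as) {N} length≡r sum≤N = begin
  a * product as                               ≤⟨ *-monoˡ-≤ (product as) (m≤m+n a slack) ⟩
  (a + slack) * product as                     ≤⟨ product≤balancedProduct[sum] d ((a + slack) ∷ as) length≡r ⟩
  balancedProduct ((a + slack) + sum as) d     ≡⟨ cong (λ M → balancedProduct M d) padded-sum ⟩
  balancedProduct N d                          ∎
  where
  open ≤-Reasoning
  slack = N ∸ (a + sum as)
  padded-sum : (a + slack) + sum as ≡ N
  padded-sum = trans (e a slack (sum as)) (m+[n∸m]≡n sum≤N)
    where
    e : ∀ a k s → (a + k) + s ≡ (a + s) + k
    e = solve-∀

-- Graphs with a critical edge

IsClique-deleteEdge : ∀ (H : Graph n) {u v} → IsClique (Adj H) p → u ∉ p ⊎ v ∉ p →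
                      IsClique (Adj (deleteEdge H u v)) p
IsClique-deleteEdge H clique (inj₁ u∉p) x y x∈p y∈p x≢y =
  clique x y x∈p y∈p x≢y , (λ { (refl , _) → u∉p x∈p }) , (λ { (_ , refl) → u∉p y∈p })
IsClique-deleteEdge H clique (inj₂ v∉p) x y x∈p y∈p x≢y =
  clique x y x∈p y∈p x≢y , (λ { (_ , refl) → v∉p y∈p }) , (λ { (refl , _) → v∉p x∈p })

IsClique-deleteEdge⁻ : ∀ (H : Graph n) {u v} → IsClique (Adj (deleteEdge H u v)) p → IsClique (Adj H) p
IsClique-deleteEdge⁻ H clique x y x∈p y∈p x≢y = proj₁ (clique x y x∈p y∈p x≢y)

coOccurrence : ∀ {t} → (Fin t → Subset n) → Graph n
coOccurrence K = record
  { Adj    = λ x y → x ≢ y × ∃[ i ] (x ∈ K i × y ∈ K i)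
  ; sym    = λ (x≢y , i , x∈ , y∈) → ≢-sym x≢y , i , y∈ , x∈
  ; irrefl = λ (x≢x , _) → x≢x refl
  }

coOccurrence? : ∀ {t} (K : Fin t → Subset n) x y → Dec (Adj (coOccurrence K) x y)
coOccurrence? K x y = ¬? (x ≟ᶠ y) ×-dec Fin.any? (λ i → x ∈? K i ×-dec y ∈? K i)

IsClique-coOccurrence : ∀ {t} (K : Fin t → Subset n) i → IsClique (Adj (coOccurrence K)) (K i)
IsClique-coOccurrence K i x y x∈ y∈ x≢y = x≢y , i , x∈ , y∈

coOccurrence⊆ : ∀ {t} {K : Fin t → Subset n} (H : Graph n) → (∀ i → IsClique (Adj H) (K i)) →
                Adj (coOccurrence K) x y → Adj H x y
coOccurrence⊆ H cliques (x≢y , i , x∈ , y∈) = cliques i _ _ x∈ y∈ x≢y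

coOccurrence-covered : ∀ {t} {K : Fin t → Subset n} → 1 < ∣ p ∣ → IsClique (Adj (coOccurrence K)) p →
                       x ∈ p → ∃[ i ] x ∈ K i
coOccurrence-covered {p = p} {x = x} 1<∣p∣ clique x∈p
  with z , z∈p-x ← ∣p∣>0⇒Nonempty {p = p - x} (s≤s⁻¹ (≤-trans 1<∣p∣ (≤-reflexive (sym (x∈p⇒suc∣p-x∣≡∣p∣ {x = x} x∈p)))))
  with _ , i , x∈K , _ ← clique x z x∈p (x∈p-y⇒x∈p z∈p-x) (≢-sym (x∈p-y⇒x≢y z∈p-x))
  = i , x∈K

module CriticalEdge {n d t} (H : Graph n)
    (K : Fin t → Subset n) (K-injective : Injective _≡_ _≡_ K) (K-cliques : ∀ i → IsKsVertexSet H (3 + d) (K i))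
    {u v} (uv : Adj H u v) (H-uv-free : KsFree (deleteEdge H u v) (3 + d)) where
  open CliqueCount (coOccurrence K) (coOccurrence? K)

  u≢v : u ≢ v
  u≢v refl = irrefl H uv

  endpoints∈ : ∀ i → u ∈ K i × v ∈ K i
  endpoints∈ i with u ∈? K i | v ∈? K i
  ... | yes u∈ | yes v∈ = u∈ , v∈
  ... | no u∉  | _      = ⊥-elim (H-uv-free (K i) (proj₁ (K-cliques i) , IsClique-deleteEdge H (proj₂ (K-cliques i)) (inj₁ u∉)))
  ... | _      | no v∉  = ⊥-elim (H-uv-free (K i) (proj₁ (K-cliques i) , IsClique-deleteEdge H (proj₂ (K-cliques i)) (inj₂ v∉)))

  suc²∣p-v-u∣≡∣p∣ : ∀ {p} → v ∈ p → u ∈ p → suc (suc ∣ p - v - u ∣) ≡ ∣ p ∣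
  suc²∣p-v-u∣≡∣p∣ v∈p u∈p =
    trans (cong ℕ.suc (x∈p⇒suc∣p-x∣≡∣p∣ (x∈p∧x≢y⇒x∈p-y u∈p u≢v))) (x∈p⇒suc∣p-x∣≡∣p∣ v∈p)

  U : Subset n
  U = ⊤ - v - u

  ∣U∣≡n∸2 : ∣ U ∣ ≡ n ∸ 2
  ∣U∣≡n∸2 = cong (_∸ 2) (trans (suc²∣p-v-u∣≡∣p∣ ∈⊤ ∈⊤) (∣⊤∣≡n n))

  K′ : Fin t → Subset n
  K′ i = K i - v - u

  F : List (Subset n)
  F = List.tabulate K′

  F-unique : Unique F
  F-unique = Unique.tabulate⁺ λ {i} {j} K′i≡K′j →
    let (u∈Ki , v∈Ki) = endpoints∈ i ; (u∈Kj , v∈Kj) = endpoints∈ j in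
    K-injective (p-x≡q-x⇒p≡q v∈Ki v∈Kj
                  (p-x≡q-x⇒p≡q (x∈p∧x≢y⇒x∈p-y u∈Ki u≢v) (x∈p∧x≢y⇒x∈p-y u∈Kj u≢v) K′i≡K′j))

  F-cliques : All (IsCliqueIn U (suc d)) F
  F-cliques = All.tabulate⁺ λ i →
      suc-injective (suc-injective (trans (suc²∣p-v-u∣≡∣p∣ (proj₂ (endpoints∈ i)) (proj₁ (endpoints∈ i)))
                                          (proj₁ (K-cliques i))))
    , p⊆q⇒p-x⊆q-x (p⊆q⇒p-x⊆q-x (λ _ → ∈⊤))
    , IsClique-⊆ (x∈p-y⇒x∈p ∘ x∈p-y⇒x∈p) (IsClique-coOccurrence K i)

  U-free : CliqueFreeIn U (suc (suc d))
  U-free T (∣T∣≡2+d , T⊆U , T-clique) =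
    H-uv-free (⁅ u ⁆ ∪ T)
      ( trans (x∉p⇒∣⁅x⁆∪p∣≡suc∣p∣ u∉T) (cong ℕ.suc ∣T∣≡2+d)
      , IsClique-deleteEdge H H-clique (inj₂ v∉⁅u⁆∪T) )
    where
    u∉T : u ∉ T
    u∉T u∈T = x∈p-y⇒x≢y (T⊆U u∈T) refl
    v∉⁅u⁆∪T : v ∉ ⁅ u ⁆ ∪ T
    v∉⁅u⁆∪T v∈ with x∈⁅y⁆∪p⁻ v∈
    ... | inj₁ v≡u = u≢v (sym v≡u)
    ... | inj₂ v∈T = x∈p-y⇒x≢y (x∈p-y⇒x∈p (T⊆U v∈T)) refl
    u-adjacent : ∀ {y} → y ∈ T → Adj H u y
    u-adjacent {y} y∈T with i , y∈Ki ← coOccurrence-covered (subst (1 <_) (sym ∣T∣≡2+d) (s≤s (s≤s z≤n))) T-clique y∈T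
      = proj₂ (K-cliques i) u y (proj₁ (endpoints∈ i)) y∈Ki λ { refl → u∉T y∈T }
    H-clique : IsClique (Adj H) (⁅ u ⁆ ∪ T)
    H-clique = IsClique-⁅x⁆∪ (Graph.sym H)
                 (λ x y x∈ y∈ x≢y → coOccurrence⊆ H (proj₂ ∘ K-cliques) (T-clique x y x∈ y∈ x≢y)) u-adjacent

  count≤product : ∃[ as ] length as ≡ suc d × sum as ≤ n ∸ 2 × t ≤ product as
  count≤product =
    let as , length-as , sum-as , length-F = cliques≤product (suc d) U F F-unique F-cliques U-free
    in as , length-as , subst (sum as ≤_) ∣U∣≡n∸2 sum-as , subst (_≤ product as) (length-tabulate K′) length-F

-- The extremal graph

<ceilDiv⇒*< : ∀ {a m} d → a < ceilDiv m d → a * suc d < m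
<ceilDiv⇒*< {a} {m} d a<⌈m/r⌉ = +-cancelʳ-≤ d (suc (a * r)) m (begin
  suc (a * r) + d     ≡⟨ cong ℕ.suc (+-comm (a * r) d) ⟩
  suc a * r           ≤⟨ *-monoˡ-≤ r a<⌈m/r⌉ ⟩
  (m + d) / r * r     ≤⟨ m/n*n≤m (m + d) r ⟩
  m + d               ∎)
  where
  open ≤-Reasoning
  r = suc d

m<n∸o⇒o+m<n : ∀ {m n o} → m < n ∸ o → o + m < n
m<n∸o⇒o+m<n {m} {n} {o} m<n∸o = subst (o + m <_) (m+[n∸m]≡n o≤n) (+-monoʳ-< o m<n∸o)
  where
  o≤n : o ≤ n
  o≤n = <⇒≤ (m∸n≢0⇒n<m (>⇒≢ (≤-<-trans z≤n m<n∸o)))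

%-/-injective : ∀ {m m′} n .{{_ : NonZero n}} → m % n ≡ m′ % n → m / n ≡ m′ / n → m ≡ m′
%-/-injective {m} {m′} n %≡ /≡ = begin
  m                   ≡⟨ m≡m%n+[m/n]*n m n ⟩
  m % n + m / n * n   ≡⟨ cong₂ (λ a b → a + b * n) %≡ /≡ ⟩
  m′ % n + m′ / n * n ≡⟨ m≡m%n+[m/n]*n m′ n ⟨
  m′                  ∎
  where open ≡-Reasoning

unrank : ∀ (h : ℕ → ℕ) r → Fin (product (applyUpTo h r)) → (j : Fin r) → Fin (h (toℕ j))
unrank h (suc r) i zero    = proj₁ (remQuot {h 0} (product (applyUpTo (h ∘ suc) r)) i)
unrank h (suc r) i (suc j) = unrank (h ∘ suc) r (proj₂ (remQuot {h 0} (product (applyUpTo (h ∘ suc) r)) i)) j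

unrank-injective : ∀ (h : ℕ → ℕ) r {i i′} → (∀ j → unrank h r i j ≡ unrank h r i′ j) → i ≡ i′
unrank-injective h zero    {zero} {zero} _ = refl
unrank-injective h (suc r) {i} {i′} eq =
  trans (sym (combine-remQuot {h 0} k i))
        (trans (cong₂ (combine {h 0}) (eq zero) (unrank-injective (h ∘ suc) r {proj₂ (remQuot {h 0} k i)} (eq ∘ suc)))
               (combine-remQuot {h 0} k i′))
  where
  k = product (applyUpTo (h ∘ suc) r)

completeMultipartite : ∀ {A : Set} → (Fin n → A) → Graph n
completeMultipartite colour = record
  { Adj    = λ x y → colour x ≢ colour y
  ; sym    = ≢-sym
  ; irrefl = λ c≢c → c≢c refl
  }

-- The edge 0–1 joined to the Turán graph on the other N vertices, whose parts are the residue classes mod d + 1.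
module ApexTuránGraph (d N : ℕ) where

  r : ℕ
  r = suc d

  part : Fin N → Fin r
  part i = toℕ i mod r

  toℕ-part : ∀ i → toℕ (part i) ≡ toℕ i % r
  toℕ-part i = toℕ-fromℕ< {m = toℕ i % r} (m%n<n (toℕ i) r)

  colour : Fin (2 + N) → Fin (2 + r)
  colour zero          = zero
  colour (suc zero)    = suc zero
  colour (suc (suc i)) = suc (suc (part i))

  H : Graph (2 + N)
  H = completeMultipartite colour

  apex-missing⇒∣p∣≤1+r : ∀ {p} a → (∀ x → colour x ≡ colour a → x ≡ a) → a ∉ p →
                         IsClique (_≢_ on colour) p → ∣ p ∣ ≤ suc r
  apex-missing⇒∣p∣≤1+r {p} a colour⁻¹[a] a∉p clique = begin
    ∣ p ∣                   ≤⟨ subset-pigeonhole colour clique avoids-colour[a] ⟩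
    ∣ ⊤ - colour a ∣        ≡⟨ ∣⊤-x∣≡n (colour a) ⟩
    suc r                   ∎
    where
    open ≤-Reasoning
    avoids-colour[a] : ∀ {x} → x ∈ p → colour x ∈ ⊤ - colour a
    avoids-colour[a] {x} x∈p = x∈p∧x≢y⇒x∈p-y ∈⊤ λ eq → a∉p (subst (_∈ p) (colour⁻¹[a] x eq) x∈p)

  H-apex-edge-free : KsFree (deleteEdge H zero (suc zero)) (3 + d)
  H-apex-edge-free p (∣p∣≡3+d , clique) with zero ∈? p | suc zero ∈? p
  ... | yes 0∈p | yes 1∈p = proj₁ (proj₂ (clique zero (suc zero) 0∈p 1∈p λ ())) (refl , refl)
  ... | no 0∉p  | _       = 1+n≰n (subst (_≤ suc r) ∣p∣≡3+d (apex-missing⇒∣p∣≤1+r zero only-zero 0∉p (IsClique-deleteEdge⁻ H clique)))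
    where
    only-zero : ∀ x → colour x ≡ zero → x ≡ zero
    only-zero zero          _  = refl
    only-zero (suc zero)    ()
    only-zero (suc (suc _)) ()
  ... | _       | no 1∉p  = 1+n≰n (subst (_≤ suc r) ∣p∣≡3+d (apex-missing⇒∣p∣≤1+r (suc zero) only-one 1∉p (IsClique-deleteEdge⁻ H clique)))
    where
    only-one : ∀ x → colour x ≡ suc zero → x ≡ suc zero
    only-one zero          ()
    only-one (suc zero)    _  = refl
    only-one (suc (suc _)) ()

  -- the number of i < N with i % r ≡ j
  partSize : ℕ → ℕ
  partSize j = ceilDiv (N ∸ j) d

  Choice : Set
  Choice = (j : Fin r) → Fin (partSize (toℕ j))

  module _ (a : Choice) where

    vertex-bound : ∀ j → toℕ j + toℕ (a j) * r < N
    vertex-bound j = m<n∸o⇒o+m<n {o = toℕ j} (<ceilDiv⇒*< {m = N ∸ toℕ j} d (toℕ<n (a j)))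

    vertex : Fin r → Fin N
    vertex j = fromℕ< (vertex-bound j)

    toℕ-vertex : ∀ j → toℕ (vertex j) ≡ toℕ j + toℕ (a j) * r
    toℕ-vertex j = toℕ-fromℕ< {m = toℕ j + toℕ (a j) * r} (vertex-bound j)

    part-vertex : ∀ j → part (vertex j) ≡ j
    part-vertex j = toℕ-injective (begin
      toℕ (part (vertex j))         ≡⟨ toℕ-part (vertex j) ⟩
      toℕ (vertex j) % r            ≡⟨ cong (_% r) (toℕ-vertex j) ⟩
      (toℕ j + toℕ (a j) * r) % r   ≡⟨ [m+kn]%n≡m%n (toℕ j) (toℕ (a j)) r ⟩
      toℕ j % r                     ≡⟨ m<n⇒m%n≡m (toℕ<n j) ⟩
      toℕ j                         ∎)
      where open ≡-Reasoning

    vertex/r : ∀ j → toℕ (vertex j) / r ≡ toℕ (a j)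
    vertex/r j = trans (cong (_/ r) (toℕ-vertex j)) ([t+q*n]/n≡q (toℕ (a j)) (toℕ<n j))

    chosen? : Decidable (λ i → toℕ i / r ≡ toℕ (a (part i)))
    chosen? i = toℕ i / r ≟ toℕ (a (part i))

    transversal : Subset N
    transversal = select chosen?

    vertex∈transversal : ∀ j → vertex j ∈ transversal
    vertex∈transversal j = ∈-select⁺ chosen? (trans (vertex/r j) (cong (λ k → toℕ (a k)) (sym (part-vertex j))))

    part-injective : IsClique (_≢_ on part) transversal
    part-injective i i′ i∈ i′∈ i≢i′ part≡ = i≢i′ (toℕ-injective (%-/-injective r %≡ /≡))
      where
      %≡ : toℕ i % r ≡ toℕ i′ % r
      %≡ = trans (sym (toℕ-part i)) (trans (cong toℕ part≡) (toℕ-part i′))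
      /≡ : toℕ i / r ≡ toℕ i′ / r
      /≡ = trans (∈-select⁻ chosen? i∈) (trans (cong (λ k → toℕ (a k)) part≡) (sym (∈-select⁻ chosen? i′∈)))

    ∣transversal∣≡r : ∣ transversal ∣ ≡ r
    ∣transversal∣≡r = ≤-antisym
      (subst (∣ transversal ∣ ≤_) (∣⊤∣≡n r) (subset-pigeonhole part part-injective (λ _ → ∈⊤)))
      (subst (_≤ ∣ transversal ∣) (∣⊤∣≡n r) (subset-pigeonhole vertex vertex-injective (λ {j} _ → vertex∈transversal j)))
      where
      vertex-injective : IsClique (_≢_ on vertex) ⊤
      vertex-injective j j′ _ _ j≢j′ eq = j≢j′ (trans (sym (part-vertex j)) (trans (cong part eq) (part-vertex j′)))

  transversal-injective : ∀ a a′ → transversal a ≡ transversal a′ → ∀ j → a j ≡ a′ j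
  transversal-injective a a′ eq j = toℕ-injective (begin
    toℕ (a j)                       ≡⟨ vertex/r a j ⟨
    toℕ (vertex a j) / r            ≡⟨ ∈-select⁻ (chosen? a′) (subst (vertex a j ∈_) eq (vertex∈transversal a j)) ⟩
    toℕ (a′ (part (vertex a j)))    ≡⟨ cong (λ k → toℕ (a′ k)) (part-vertex a j) ⟩
    toℕ (a′ j)                      ∎)
    where open ≡-Reasoning

  colour-injective : ∀ {p} → IsClique (_≢_ on part) p → IsClique (_≢_ on colour) (inside ∷ inside ∷ p)
  colour-injective injective (suc (suc i)) (suc (suc j)) (there (there i∈)) (there (there j∈)) x≢y eq =
    injective i j i∈ j∈ (x≢y ∘ cong (λ (k : Fin N) → suc (suc k))) (Fin.suc-injective (Fin.suc-injective eq))
  colour-injective _ zero          zero          _ _ x≢y _  = x≢y refl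
  colour-injective _ (suc zero)    (suc zero)    _ _ x≢y _  = x≢y refl
  colour-injective _ zero          (suc zero)    _ _ _   ()
  colour-injective _ zero          (suc (suc _)) _ _ _   ()
  colour-injective _ (suc zero)    zero          _ _ _   ()
  colour-injective _ (suc zero)    (suc (suc _)) _ _ _   ()
  colour-injective _ (suc (suc _)) zero          _ _ _   ()
  colour-injective _ (suc (suc _)) (suc zero)    _ _ _   ()

  choice : Fin (balancedProduct N d) → Choice
  choice i = unrank partSize r (cast (cong product (map-upTo partSize r)) i)

  K : Fin (balancedProduct N d) → Subset (2 + N)
  K i = inside ∷ inside ∷ transversal (choice i)

  K-injective : Injective _≡_ _≡_ K
  K-injective {i} {i′} K≡ = toℕ-injective (begin
    toℕ i             ≡⟨ toℕ-cast _ i ⟨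
    toℕ (cast _ i)    ≡⟨ cong toℕ (unrank-injective partSize r (transversal-injective _ _ (cong (tail ∘ tail) K≡))) ⟩
    toℕ (cast _ i′)   ≡⟨ toℕ-cast _ i′ ⟩
    toℕ i′            ∎)
    where open ≡-Reasoning

  K-cliques : ∀ i → IsKsVertexSet H (3 + d) (K i)
  K-cliques i = cong (ℕ.suc ∘ ℕ.suc) (∣transversal∣≡r (choice i)) , colour-injective (part-injective (choice i))

  extremal : Σ (Graph (2 + N)) λ H → HasDistinctKs H (3 + d) (balancedProduct N d) × HasCriticalEdge H (3 + d)
  extremal = H , (K , K-injective , K-cliques) , zero , suc zero , (λ ()) , H-apex-edge-free

lemma3p1 : ∀ (s : ℕ) → 3 ≤ s →
    (∀ (n : ℕ) → s ≤ n → (H : Graph n) → (t : ℕ) →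
       HasDistinctKs H s t → HasCriticalEdge H s → t ≤ bound n s)
  × (∀ (n : ℕ) → s ≤ n →
       Σ (Graph n) λ H → HasDistinctKs H s (bound n s) × HasCriticalEdge H s)
lemma3p1 (suc (suc (suc d))) (s≤s (s≤s (s≤s z≤n))) = upper , lower
  where
  upper : ∀ n → 3 + d ≤ n → (H : Graph n) → ∀ t →
          HasDistinctKs H (3 + d) t → HasCriticalEdge H (3 + d) → t ≤ bound n (3 + d)
  upper n _ H t (K , K-injective , K-cliques) (u , v , uv , H-uv-free) =
    let as , length-as , sum-as , t≤product = CriticalEdge.count≤product H K K-injective K-cliques uv H-uv-free
    in ≤-trans t≤product (product≤balancedProduct d as length-as sum-as)

  lower : ∀ n → 3 + d ≤ n → Σ (Graph n) λ H → HasDistinctKs H (3 + d) (bound n (3 + d)) × HasCriticalEdge H (3 + d)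
  lower (suc (suc N)) (s≤s (s≤s _)) = ApexTuránGraph.extremal d N
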